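{- Let $G$ be a graph with four distinct nominated vertices $a,b,c,d$, such that $N_G(a)=N_G(b)=\{u,v\}$ for some distinct vertices $u,v\in V(G)\setminus\{a,b,c,d\}$. Let $G'$ be the graph obtained from $G$ by deleting $a$ and $b$ and adding the edge $uv$. Then $G$ contains a $K_4$-minor rooted at $a,b,c,d$ if and only if $G'$ contains a $K_4$-minor rooted at $u,v,c,d$.
   Context: Graphs are finite, simple and undirected; $N_G(x)$ is the set of neighbours of $x$ in $G$. A $K_4$-minor rooted at $x_1,x_2,x_3,x_4$ in a graph is a set of four pairwise vertex-disjoint connected subgraphs, respectively containing $x_1,\dots,x_4$, every two of which are joined by an edge. -}

module Defs where

open import Data.Bool using (Bool; true; false; T; not; _∧_; _∨_)
open import Data.Bool.Properties using (T-irrelevant; ∨-comm)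
open import Data.Fin using (Fin)
import Data.Fin as Fin
open import Data.List using (List; []; _∷_)
open import Data.List.Membership.Propositional using (_∈_)
open import Data.List.Relation.Unary.Any using (here; there)
open import Data.Product using (Σ; _,_; proj₁; proj₂; _×_; ∃₂)
open import Data.Sum using (_⊎_)
open import Data.Empty using (⊥; ⊥-elim)
open import Relation.Nullary using (¬_; yes; no; does)
open import Relation.Nullary.Decidable using (T?)
open import Relation.Binary.Definitions using (DecidableEquality)
open import Relation.Binary.PropositionalEquality
  using (_≡_; _≢_; refl; sym; cong; subst)

record Graph : Set₁ where
  field
    V        : Set
    _≟_      : DecidableEquality V
    vertices : List V
    complete : ∀ x → x ∈ vertices
    E        : V → V → Bool
    E-sym    : ∀ x y → E x y ≡ E y x
    E-irrefl : ∀ x → E x x ≡ false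

  Adj : V → V → Set
  Adj x y = T (E x y)

  NeighbourhoodIs : V → V → V → Set
  NeighbourhoodIs x u v = ∀ y → (Adj x y → (y ≡ u) ⊎ (y ≡ v)) × ((y ≡ u) ⊎ (y ≡ v) → Adj x y)

open Graph public

roots : {A : Set} → A → A → A → A → Fin 4 → A
roots x₁ x₂ x₃ x₄ Fin.zero = x₁
roots x₁ x₂ x₃ x₄ (Fin.suc Fin.zero) = x₂
roots x₁ x₂ x₃ x₄ (Fin.suc (Fin.suc Fin.zero)) = x₃
roots x₁ x₂ x₃ x₄ (Fin.suc (Fin.suc (Fin.suc Fin.zero))) = x₄

Subset : Graph → Set
Subset G = V G → Bool

_∈ˢ_ : {G : Graph} → V G → Subset G → Set
x ∈ˢ S = T (S x)

data WalkIn (G : Graph) (S : Subset G) : V G → V G → Set where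
  stop : ∀ {x} → T (S x) → WalkIn G S x x
  step : ∀ {x y z} → T (S x) → Adj G x y → WalkIn G S y z → WalkIn G S x z

Connected : (G : Graph) → Subset G → Set
Connected G S = ∀ x y → T (S x) → T (S y) → WalkIn G S x y

record RootedK4Minor (G : Graph) (r : Fin 4 → V G) : Set where
  field
    branch   : Fin 4 → Subset G
    rooted   : ∀ i → T (branch i (r i))
    disjoint : ∀ i j → i ≢ j → ∀ x → T (branch i x) → T (branch j x) → ⊥
    conn     : ∀ i → Connected G (branch i)
    joined   : ∀ i j → i ≢ j →
               ∃₂ λ x y → T (branch i x) × T (branch j y) × Adj G x y

module Reduction (G : Graph) (a b u v : V G) (u≢v : u ≢ v) where
  _≟G_ : DecidableEquality (V G)
  _≟G_ = _≟_ G

  keep : V G → Bool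
  keep x = not (does (x ≟G a)) ∧ not (does (x ≟G b))

  V' : Set
  V' = Σ (V G) λ x → T (keep x)

  keep-intro : ∀ {x} → x ≢ a → x ≢ b → T (keep x)
  keep-intro {x} p q with x ≟G a | x ≟G b
  ... | yes e | _     = ⊥-elim (p e)
  ... | no _  | yes e = ⊥-elim (q e)
  ... | no _  | no _  = _

  dec' : DecidableEquality V'
  dec' (x , p) (y , q) with x ≟G y
  ... | yes refl = yes (cong (x ,_) (T-irrelevant p q))
  ... | no ne    = no λ e → ne (cong proj₁ e)

  filt : List (V G) → List V'
  filt [] = []
  filt (x ∷ xs) with T? (keep x)
  ... | yes p = (x , p) ∷ filt xs
  ... | no _  = filt xs

  filt-complete : ∀ {x} (p : T (keep x)) xs → x ∈ xs → (x , p) ∈ filt xs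
  filt-complete p (y ∷ ys) (here refl) with T? (keep y)
  ... | yes q = here (cong (y ,_) (T-irrelevant p q))
  ... | no nq = ⊥-elim (nq p)
  filt-complete p (y ∷ ys) (there m) with T? (keep y)
  ... | yes _ = there (filt-complete p ys m)
  ... | no _  = filt-complete p ys m

  isUV : V G → V G → Bool
  isUV x y = does (x ≟G u) ∧ does (y ≟G v)

  E' : V' → V' → Bool
  E' (x , _) (y , _) = E G x y ∨ (isUV x y ∨ isUV y x)

  E'-sym : ∀ x y → E' x y ≡ E' y x
  E'-sym (x , _) (y , _) rewrite E-sym G x y | ∨-comm (isUV x y) (isUV y x) = refl

  isUV-irr : ∀ x → isUV x x ≡ false
  isUV-irr x with x ≟G u | x ≟G v
  ... | yes refl | yes e = ⊥-elim (u≢v e)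
  ... | yes _    | no _  = refl
  ... | no _     | _     = refl

  E'-irrefl : ∀ x → E' x x ≡ false
  E'-irrefl (x , _) rewrite E-irrefl G x | isUV-irr x = refl

  G' : Graph
  G' = record
    { V        = V'
    ; _≟_      = dec'
    ; vertices = filt (vertices G)
    ; complete = λ { (x , p) → filt-complete p (vertices G) (complete G x) }
    ; E        = E'
    ; E-sym    = E'-sym
    ; E-irrefl = E'-irrefl
    }

-- The branch containing a must reach three other branches, yet a's only
-- neighbours are u and v, and three disjoint branches cannot all contain one
-- of them; so the branch of a contains u or v, and likewise the branch of b.  Being
-- disjoint, they contain u and v respectively (up to swapping the two roots).
-- Deleting a and b then keeps every branch connected, since a walk through a
-- enters and leaves it through the same vertex of {u, v}, and a branch edge
-- at a or b is replaced by the new edge uv.  Conversely, putting a into the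
-- branch of u and b into that of v turns the edge uv into the edge av.
module Submission where

open import Data.Bool using (false; T)
open import Data.Bool.Properties using (T-∧; T-∨; T-irrelevant)
open import Data.Empty using (⊥; ⊥-elim)
open import Data.Fin using (Fin; punchIn)
import Data.Fin as Fin
open import Data.Fin.Patterns using (0F; 1F; 2F; 3F)
open import Data.Fin.Permutation using (Permutation′; _⟨$⟩ʳ_; _⟨$⟩ˡ_; inverseˡ; transpose)
open import Data.Fin.Properties using (punchIn-injective; punchInᵢ≢i)
open import Data.Product using (Σ; ∃; ∃₂; _×_; _,_; proj₁; proj₂)
open import Data.Sum using (_⊎_; inj₁; inj₂)
open import Function.Base using (_∘_)
open import Function.Bundles using (_⇔_; mk⇔; Equivalence)
open import Relation.Binary.PropositionalEquality
  using (_≡_; _≢_; refl; sym; trans; cong; subst; ≢-sym)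
open import Relation.Nullary using (¬_; Dec; yes; no; does)
open import Relation.Nullary.Decidable using (T?)

open import Defs

open Equivalence using (to; from)

does-sound : ∀ {P : Set} (p? : Dec P) → T (does p?) → P
does-sound (yes p) _ = p

does-complete : ∀ {P : Set} (p? : Dec P) → P → T (does p?)
does-complete (yes _) _ = _
does-complete (no ¬p) p = ¬p p

Adj-sym : ∀ {H : Graph} {x y} → Adj H x y → Adj H y x
Adj-sym {H} {x} {y} = subst T (E-sym H x y)

module _ {H : Graph} {S : Subset H} where

  walkIn-head : ∀ {x y} → WalkIn H S x y → T (S x)
  walkIn-head (stop x∈) = x∈
  walkIn-head (step x∈ _ _) = x∈

  infixr 5 _++ʷ_

  _++ʷ_ : ∀ {x y z} → WalkIn H S x y → WalkIn H S y z → WalkIn H S x z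
  stop _ ++ʷ q = q
  step x∈ x~y p ++ʷ q = step x∈ x~y (p ++ʷ q)

  walkIn-reverse : ∀ {x y} → WalkIn H S x y → WalkIn H S y x
  walkIn-reverse (stop x∈) = stop x∈
  walkIn-reverse (step x∈ x~y p) =
    walkIn-reverse p ++ʷ step (walkIn-head p) (Adj-sym {H} x~y) (stop x∈)

  walkIn-leaves : ∀ {x y} → x ≢ y → WalkIn H S x y → ∃ λ z → T (S z) × Adj H x z
  walkIn-leaves x≢x (stop _) = ⊥-elim (x≢x refl)
  walkIn-leaves _ (step _ x~z p) = _ , walkIn-head p , x~z

reroot : ∀ {H r r′} → RootedK4Minor H r → (∀ i → r i ≡ r′ i) → RootedK4Minor H r′
reroot {H} M r≗r′ = record
  { branch   = branch
  ; rooted   = λ i → subst (T ∘ branch i) (r≗r′ i) (rooted i)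
  ; disjoint = disjoint
  ; conn     = conn
  ; joined   = joined
  }
  where open RootedK4Minor M

relabel : ∀ {H r} (π : Permutation′ 4) → RootedK4Minor H r → RootedK4Minor H (r ∘ (π ⟨$⟩ʳ_))
relabel {H} π M = record
  { branch   = branch ∘ σ
  ; rooted   = rooted ∘ σ
  ; disjoint = λ i j i≢j → disjoint (σ i) (σ j) (i≢j ∘ σ-injective)
  ; conn     = conn ∘ σ
  ; joined   = λ i j i≢j → joined (σ i) (σ j) (i≢j ∘ σ-injective)
  }
  where
  open RootedK4Minor M
  σ = π ⟨$⟩ʳ_
  σ-injective : ∀ {i j} → σ i ≡ σ j → i ≡ j
  σ-injective e = trans (sym (inverseˡ π)) (trans (cong (π ⟨$⟩ˡ_) e) (inverseˡ π))

module _ {H : Graph} {r : Fin 4 → V H} (M : RootedK4Minor H r) where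
  open RootedK4Minor M

  Meets : Fin 4 → V H → V H → Set
  Meets i u v = T (branch i u) ⊎ T (branch i v)

  meets-at : ∀ {i u v w} → w ≡ u ⊎ w ≡ v → T (branch i w) → Meets i u v
  meets-at (inj₁ refl) w∈ = inj₁ w∈
  meets-at (inj₂ refl) w∈ = inj₂ w∈

  branch-unique : ∀ {i j x} → T (branch i x) → T (branch j x) → i ≡ j
  branch-unique {i} {j} {x} x∈i x∈j with i Fin.≟ j
  ... | yes i≡j = i≡j
  ... | no i≢j = ⊥-elim (disjoint i j i≢j x x∈i x∈j)

  branches-separate : ∀ {i j x y} → i ≢ j → T (branch i x) → T (branch j y) →
                      ∀ {k} → T (branch k x) → T (branch k y) → ⊥
  branches-separate i≢j x∈i y∈j x∈k y∈k =
    i≢j (trans (branch-unique x∈i x∈k) (sym (branch-unique y∈j y∈k)))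

  ¬three-meet : ∀ {i j k u v} → i ≢ j → i ≢ k → j ≢ k →
                Meets i u v → Meets j u v → Meets k u v → ⊥
  ¬three-meet {i} {j} i≢j _ _ (inj₁ u∈i) (inj₁ u∈j) _ = disjoint i j i≢j _ u∈i u∈j
  ¬three-meet {i} {k = k} _ i≢k _ (inj₁ u∈i) (inj₂ _) (inj₁ u∈k) = disjoint i k i≢k _ u∈i u∈k
  ¬three-meet {j = j} {k} _ _ j≢k (inj₁ _) (inj₂ v∈j) (inj₂ v∈k) = disjoint j k j≢k _ v∈j v∈k
  ¬three-meet {j = j} {k} _ _ j≢k (inj₂ _) (inj₁ u∈j) (inj₁ u∈k) = disjoint j k j≢k _ u∈j u∈k
  ¬three-meet {i} {k = k} _ i≢k _ (inj₂ v∈i) (inj₁ _) (inj₂ v∈k) = disjoint i k i≢k _ v∈i v∈k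
  ¬three-meet {i} {j} i≢j _ _ (inj₂ v∈i) (inj₂ v∈j) _ = disjoint i j i≢j _ v∈i v∈j

  meets-here-or-there : ∀ {i j w u v} → NeighbourhoodIs H w u v → T (branch i w) → j ≢ i →
                        Meets i u v ⊎ Meets j u v
  meets-here-or-there {i} {j} {w} N w∈ j≢i with joined i j (≢-sym j≢i)
  ... | x , y , x∈ , y∈ , x~y with _≟_ H x w
  ...   | yes refl = inj₂ (meets-at (proj₁ (N y) x~y) y∈)
  ...   | no x≢w with walkIn-leaves (≢-sym x≢w) (conn i w x w∈ x∈)
  ...     | z , z∈ , w~z = inj₁ (meets-at (proj₁ (N z) w~z) z∈)

  -- The three branches other than i are those of punchIn i 0, 1 and 2.
  branch-meets-neighbourhood : ∀ {i w u v} → NeighbourhoodIs H w u v → T (branch i w) →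
                               Meets i u v
  branch-meets-neighbourhood {i} N w∈
    with meets-here-or-there N w∈ (punchInᵢ≢i i 0F)
       | meets-here-or-there N w∈ (punchInᵢ≢i i 1F)
       | meets-here-or-there N w∈ (punchInᵢ≢i i 2F)
  ... | inj₁ m | _ | _ = m
  ... | inj₂ _ | inj₁ m | _ = m
  ... | inj₂ _ | inj₂ _ | inj₁ m = m
  ... | inj₂ m₀ | inj₂ m₁ | inj₂ m₂ =
    ⊥-elim (¬three-meet (others (λ ())) (others (λ ())) (others (λ ())) m₀ m₁ m₂)
    where
    others : ∀ {j k} → j ≢ k → punchIn i j ≢ punchIn i k
    others j≢k = j≢k ∘ punchIn-injective i _ _

module Reduced (G : Graph) (a b u v : V G) (a≢b : a ≢ b) (u≢v : u ≢ v)
  (u≢a : u ≢ a) (u≢b : u ≢ b) (v≢a : v ≢ a) (v≢b : v ≢ b)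
  (Na : NeighbourhoodIs G a u v) (Nb : NeighbourhoodIs G b u v) where

  open Reduction G a b u v u≢v

  û v̂ : V'
  û = u , keep-intro u≢a u≢b
  v̂ = v , keep-intro v≢a v≢b

  kept-≡ : ∀ {x y} (kx : T (keep x)) (ky : T (keep y)) → x ≡ y → _≡_ {A = V'} (x , kx) (y , ky)
  kept-≡ kx ky refl = cong (_ ,_) (T-irrelevant kx ky)

  kept-≢ : ∀ {x} → T (keep x) → x ≢ a × x ≢ b
  kept-≢ {x} k with x ≟G a | x ≟G b
  ... | no x≢a | no x≢b = x≢a , x≢b

  removed : ∀ {x} → ¬ T (keep x) → x ≡ a ⊎ x ≡ b
  removed {x} ¬k with x ≟G a | x ≟G b
  ... | yes x≡a | _ = inj₁ x≡a
  ... | no _ | yes x≡b = inj₂ x≡b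
  ... | no _ | no _ = ⊥-elim (¬k _)

  removed-neighbourhood : ∀ {w} → ¬ T (keep w) → NeighbourhoodIs G w u v
  removed-neighbourhood ¬k with removed ¬k
  ... | inj₁ refl = Na
  ... | inj₂ refl = Nb

  E'-intro : ∀ {x y} (kx : T (keep x)) (ky : T (keep y)) → Adj G x y → T (E' (x , kx) (y , ky))
  E'-intro {x} {y} _ _ x~y = from (T-∨ {E G x y}) (inj₁ x~y)

  û~v̂ : T (E' û v̂)
  û~v̂ = from (T-∨ {E G u v}) (inj₂ (from (T-∨ {isUV u v}) (inj₁ uv)))
    where
    uv : T (isUV u v)
    uv = from (T-∧ {does (u ≟G u)}) (does-complete (u ≟G u) refl , does-complete (v ≟G v) refl)

  v̂~û : T (E' v̂ û)
  v̂~û = subst T (E'-sym û v̂) û~v̂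

  isUV-sound : ∀ {x y} → T (isUV x y) → x ≡ u × y ≡ v
  isUV-sound {x} {y} h with to (T-∧ {does (x ≟G u)}) h
  ... | x≟u , y≟v = does-sound (x ≟G u) x≟u , does-sound (y ≟G v) y≟v

  E'-elim : ∀ {x y : V'} → T (E' x y) →
            Adj G (proj₁ x) (proj₁ y) ⊎ (x ≡ û × y ≡ v̂) ⊎ (x ≡ v̂ × y ≡ û)
  E'-elim {x , kx} {y , ky} h with to (T-∨ {E G x y}) h
  ... | inj₁ x~y = inj₁ x~y
  ... | inj₂ h′ with to (T-∨ {isUV x y}) h′
  ...   | inj₁ xy with isUV-sound xy
  ...     | x≡u , y≡v = inj₂ (inj₁ (kept-≡ kx _ x≡u , kept-≡ ky _ y≡v))
  E'-elim {x , kx} {y , ky} h | inj₂ _ | inj₂ yx with isUV-sound yx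
  ...     | y≡u , x≡v = inj₂ (inj₂ (kept-≡ kx _ x≡v , kept-≡ ky _ y≡u))

  expand-walk : ∀ {S′ : Subset G'} {S : Subset G} → (∀ {x} → T (S′ x) → T (S (proj₁ x))) →
                (T (S′ û) → T (S′ v̂) → ⊥) →
                ∀ {x y} → WalkIn G' S′ x y → WalkIn G S (proj₁ x) (proj₁ y)
  expand-walk ⊆S sep (stop x∈) = stop (⊆S x∈)
  expand-walk ⊆S sep (step {x} {y} x∈ x~y p) with E'-elim {x} {y} x~y
  ... | inj₁ x~y′ = step (⊆S x∈) x~y′ (expand-walk ⊆S sep p)
  ... | inj₂ (inj₁ (refl , refl)) = ⊥-elim (sep x∈ (walkIn-head p))
  ... | inj₂ (inj₂ (refl , refl)) = ⊥-elim (sep (walkIn-head p) x∈)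

  module _ {r : Fin 4 → V G} (M : RootedK4Minor G r)
           (separated : ∀ {i} → T (RootedK4Minor.branch M i u) →
                                T (RootedK4Minor.branch M i v) → ⊥) where
    open RootedK4Minor M

    removed-neighbours-≡ : ∀ {i w y z} → ¬ T (keep w) → T (branch i y) → T (branch i z) →
                           Adj G y w → Adj G w z → y ≡ z
    removed-neighbours-≡ {y = y} {z} ¬kw y∈ z∈ y~w w~z
      with proj₁ (removed-neighbourhood ¬kw y) (Adj-sym {G} y~w)
         | proj₁ (removed-neighbourhood ¬kw z) w~z
    ... | inj₁ refl | inj₁ refl = refl
    ... | inj₂ refl | inj₂ refl = refl
    ... | inj₁ refl | inj₂ refl = ⊥-elim (separated y∈ z∈)
    ... | inj₂ refl | inj₁ refl = ⊥-elim (separated z∈ y∈)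

    reduce-walk : ∀ {i x y} (kx : T (keep x)) (ky : T (keep y)) → WalkIn G (branch i) x y →
                  WalkIn G' (branch i ∘ proj₁) (x , kx) (y , ky)
    reduce-walk {i} kx ky (stop x∈) =
      subst (WalkIn G' (branch i ∘ proj₁) _) (kept-≡ kx ky refl) (stop x∈)
    reduce-walk kx ky (step {y = w} x∈ x~w p) with T? (keep w)
    ... | yes kw = step x∈ (E'-intro kx kw x~w) (reduce-walk kw ky p)
    reduce-walk kx ky (step x∈ x~w (stop _)) | no ¬kw = ⊥-elim (¬kw ky)
    reduce-walk kx ky (step x∈ x~w (step _ w~z p)) | no ¬kw
      with removed-neighbours-≡ ¬kw x∈ (walkIn-head p) x~w w~z
    ... | refl = reduce-walk kx ky p

    meeting-branches-joined : ∀ {i j} → i ≢ j → Meets M i u v → Meets M j u v →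
      ∃₂ λ x y → T (branch i (proj₁ x)) × T (branch j (proj₁ y)) × T (E' x y)
    meeting-branches-joined {i} {j} i≢j (inj₁ u∈i) (inj₁ u∈j) =
      ⊥-elim (disjoint i j i≢j u u∈i u∈j)
    meeting-branches-joined i≢j (inj₁ u∈i) (inj₂ v∈j) = û , v̂ , u∈i , v∈j , û~v̂
    meeting-branches-joined i≢j (inj₂ v∈i) (inj₁ u∈j) = v̂ , û , v∈i , u∈j , v̂~û
    meeting-branches-joined {i} {j} i≢j (inj₂ v∈i) (inj₂ v∈j) =
      ⊥-elim (disjoint i j i≢j v v∈i v∈j)

    reduce-joined : ∀ i j → i ≢ j →
      ∃₂ λ x y → T (branch i (proj₁ x)) × T (branch j (proj₁ y)) × T (E' x y)
    reduce-joined i j i≢j with joined i j i≢j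
    ... | x , y , x∈ , y∈ , x~y with T? (keep x) | T? (keep y)
    ...   | yes kx | yes ky = (x , kx) , (y , ky) , x∈ , y∈ , E'-intro kx ky x~y
    ...   | no ¬kx | _ = meeting-branches-joined i≢j
            (branch-meets-neighbourhood M (removed-neighbourhood ¬kx) x∈)
            (meets-at M (proj₁ (removed-neighbourhood ¬kx y) x~y) y∈)
    ...   | yes _ | no ¬ky = meeting-branches-joined i≢j
            (meets-at M (proj₁ (removed-neighbourhood ¬ky x) (Adj-sym {G} x~y)) x∈)
            (branch-meets-neighbourhood M (removed-neighbourhood ¬ky) y∈)

    reduce-minor : (r′ : Fin 4 → V') → (∀ i → T (branch i (proj₁ (r′ i)))) → RootedK4Minor G' r′
    reduce-minor _ rooted′ = record
      { branch   = λ i → branch i ∘ proj₁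
      ; rooted   = rooted′
      ; disjoint = λ i j i≢j x → disjoint i j i≢j (proj₁ x)
      ; conn     = λ i x y x∈ y∈ → reduce-walk (proj₂ x) (proj₂ y) (conn i _ _ x∈ y∈)
      ; joined   = reduce-joined
      }

  module _ {ĉ d̂ : V'} (M : RootedK4Minor G (roots a b (proj₁ ĉ) (proj₁ d̂))) where
    open RootedK4Minor M

    rooted-at : ∀ x y → T (branch 0F (proj₁ x)) → T (branch 1F (proj₁ y)) →
                ∀ i → T (branch i (proj₁ (roots x y ĉ d̂ i)))
    rooted-at _ _ x∈ _ 0F = x∈
    rooted-at _ _ _ y∈ 1F = y∈
    rooted-at _ _ _ _ 2F = rooted 2F
    rooted-at _ _ _ _ 3F = rooted 3F

    reduce : RootedK4Minor G' (roots û v̂ ĉ d̂)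
    reduce with branch-meets-neighbourhood M Na (rooted 0F)
              | branch-meets-neighbourhood M Nb (rooted 1F)
    ... | inj₁ u∈0 | inj₁ u∈1 = ⊥-elim (disjoint 0F 1F (λ ()) u u∈0 u∈1)
    ... | inj₂ v∈0 | inj₂ v∈1 = ⊥-elim (disjoint 0F 1F (λ ()) v v∈0 v∈1)
    ... | inj₁ u∈0 | inj₂ v∈1 =
      reduce-minor M (branches-separate M (λ ()) u∈0 v∈1)
                     (roots û v̂ ĉ d̂) (rooted-at û v̂ u∈0 v∈1)
    ... | inj₂ v∈0 | inj₁ u∈1 =
      reroot (relabel (transpose 0F 1F) reduced-swapped)
             (λ { 0F → refl ; 1F → refl ; 2F → refl ; 3F → refl })
      where
      reduced-swapped : RootedK4Minor G' (roots v̂ û ĉ d̂)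
      reduced-swapped = reduce-minor M (λ u∈ v∈ → branches-separate M (λ ()) v∈0 u∈1 v∈ u∈)
                                     (roots v̂ û ĉ d̂) (rooted-at v̂ û v∈0 u∈1)

  extendWith : Subset G' → Subset G → Subset G
  extendWith S′ A x with T? (keep x)
  ... | yes k = S′ (x , k)
  ... | no _ = A x

  extendWith-kept : ∀ {S′ A x} (k : T (keep x)) → extendWith S′ A x ≡ S′ (x , k)
  extendWith-kept {S′} {x = x} k with T? (keep x)
  ... | yes k′ = cong S′ (kept-≡ k′ k refl)
  ... | no ¬k = ⊥-elim (¬k k)

  extendWith-removed : ∀ {S′ A x} → ¬ T (keep x) → extendWith S′ A x ≡ A x
  extendWith-removed {x = x} ¬k with T? (keep x)
  ... | yes k = ⊥-elim (¬k k)
  ... | no _ = refl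

  added : Fin 4 → Subset G
  added 0F x = does (x ≟G a)
  added 1F x = does (x ≟G b)
  added _ _ = false

  added-sound : ∀ {i x} → T (added i x) → (i ≡ 0F × x ≡ a) ⊎ (i ≡ 1F × x ≡ b)
  added-sound {0F} {x} h = inj₁ (refl , does-sound (x ≟G a) h)
  added-sound {1F} {x} h = inj₂ (refl , does-sound (x ≟G b) h)

  module _ {r′ : Fin 4 → V'} (M′ : RootedK4Minor G' r′)
           (û∈0 : T (RootedK4Minor.branch M′ 0F û)) (v̂∈1 : T (RootedK4Minor.branch M′ 1F v̂)) where
    open RootedK4Minor M′ renaming
      (branch to branch′; rooted to rooted′; disjoint to disjoint′; conn to conn′; joined to joined′)

    expanded : Fin 4 → Subset G
    expanded i = extendWith (branch′ i) (added i)

    ∈-expanded : ∀ {i x} → T (branch′ i x) → T (expanded i (proj₁ x))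
    ∈-expanded {x = _ , k} = subst T (sym (extendWith-kept k))

    expanded-kept : ∀ {i x} (k : T (keep x)) → T (expanded i x) → T (branch′ i (x , k))
    expanded-kept k = subst T (extendWith-kept k)

    expanded-removed : ∀ {i x} → ¬ T (keep x) → T (expanded i x) →
                       (i ≡ 0F × x ≡ a) ⊎ (i ≡ 1F × x ≡ b)
    expanded-removed ¬k = added-sound ∘ subst T (extendWith-removed ¬k)

    a∈expanded : T (expanded 0F a)
    a∈expanded = subst T (sym (extendWith-removed (λ k → proj₁ (kept-≢ k) refl)))
                       (does-complete (a ≟G a) refl)

    b∈expanded : T (expanded 1F b)
    b∈expanded = subst T (sym (extendWith-removed (λ k → proj₂ (kept-≢ k) refl)))
                       (does-complete (b ≟G b) refl)

    reach-kept : ∀ {i x} → T (expanded i x) →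
                 Σ V' λ x̃ → T (branch′ i x̃) × WalkIn G (expanded i) x (proj₁ x̃)
    reach-kept {x = x} x∈ = reach (T? (keep x))
      where
      reach : Dec (T (keep x)) → Σ V' λ x̃ → T (branch′ _ x̃) × WalkIn G (expanded _) x (proj₁ x̃)
      reach (yes k) = (x , k) , expanded-kept k x∈ , stop x∈
      reach (no ¬k) with expanded-removed ¬k x∈
      ... | inj₁ (refl , refl) =
        û , û∈0 , step x∈ (proj₂ (Na u) (inj₁ refl)) (stop (∈-expanded û∈0))
      ... | inj₂ (refl , refl) =
        v̂ , v̂∈1 , step x∈ (proj₂ (Nb v) (inj₂ refl)) (stop (∈-expanded v̂∈1))

    expand-conn : ∀ i → Connected G (expanded i)
    expand-conn i x y x∈ y∈ with reach-kept x∈ | reach-kept y∈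
    ... | x̃ , x̃∈ , x⇝x̃ | ỹ , ỹ∈ , y⇝ỹ =
      x⇝x̃ ++ʷ expand-walk ∈-expanded (branches-separate M′ (λ ()) û∈0 v̂∈1) (conn′ i x̃ ỹ x̃∈ ỹ∈)
           ++ʷ walkIn-reverse y⇝ỹ

    expand-disjoint : ∀ i j → i ≢ j → ∀ x → T (expanded i x) → T (expanded j x) → ⊥
    expand-disjoint i j i≢j x x∈i x∈j = separate (T? (keep x))
      where
      separate : Dec (T (keep x)) → ⊥
      separate (yes k) = disjoint′ i j i≢j (x , k) (expanded-kept k x∈i) (expanded-kept k x∈j)
      separate (no ¬k) with expanded-removed ¬k x∈i | expanded-removed ¬k x∈j
      ... | inj₁ (refl , _) | inj₁ (refl , _) = i≢j refl
      ... | inj₂ (refl , _) | inj₂ (refl , _) = i≢j refl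
      ... | inj₁ (_ , x≡a) | inj₂ (_ , x≡b) = a≢b (trans (sym x≡a) x≡b)
      ... | inj₂ (_ , x≡b) | inj₁ (_ , x≡a) = a≢b (trans (sym x≡a) x≡b)

    expand-joined : ∀ i j → i ≢ j → ∃₂ λ x y → T (expanded i x) × T (expanded j y) × Adj G x y
    expand-joined i j i≢j with joined′ i j i≢j
    ... | x , y , x∈ , y∈ , x~y with E'-elim {x} {y} x~y
    ...   | inj₁ x~y′ = _ , _ , ∈-expanded x∈ , ∈-expanded y∈ , x~y′
    ...   | inj₂ (inj₁ (refl , refl)) with branch-unique M′ û∈0 x∈
    ...     | refl = a , v , a∈expanded , ∈-expanded y∈ , proj₂ (Na v) (inj₂ refl)
    expand-joined i j i≢j | x , y , x∈ , y∈ , x~y | inj₂ (inj₂ (refl , refl))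
      with branch-unique M′ v̂∈1 x∈
    ... | refl = b , u , b∈expanded , ∈-expanded y∈ , proj₂ (Nb u) (inj₁ refl)

    expand-minor : RootedK4Minor G (roots a b (proj₁ (r′ 2F)) (proj₁ (r′ 3F)))
    expand-minor = record
      { branch   = expanded
      ; rooted   = λ { 0F → a∈expanded ; 1F → b∈expanded
                     ; 2F → ∈-expanded (rooted′ 2F) ; 3F → ∈-expanded (rooted′ 3F) }
      ; disjoint = expand-disjoint
      ; conn     = expand-conn
      ; joined   = expand-joined
      }

lemma13 : (G : Graph) (a b c d u v : V G) →
    a ≢ b → (a≢c : a ≢ c) → (a≢d : a ≢ d) → (b≢c : b ≢ c) → (b≢d : b ≢ d) → c ≢ d →
    (u≢v : u ≢ v) →
    (u≢a : u ≢ a) → (u≢b : u ≢ b) → u ≢ c → u ≢ d →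
    (v≢a : v ≢ a) → (v≢b : v ≢ b) → v ≢ c → v ≢ d →
    NeighbourhoodIs G a u v → NeighbourhoodIs G b u v →
    let open Reduction G a b u v u≢v in
    RootedK4Minor G (roots a b c d)
      ⇔ RootedK4Minor G' (roots (u , keep-intro u≢a u≢b) (v , keep-intro v≢a v≢b)
                               (c , keep-intro (≢-sym a≢c) (≢-sym b≢c))
                               (d , keep-intro (≢-sym a≢d) (≢-sym b≢d)))
lemma13 G a b c d u v a≢b _ _ _ _ _ u≢v u≢a u≢b _ _ v≢a v≢b _ _ Na Nb =
  mk⇔ reduce (λ M′ → expand-minor M′ (rooted M′ 0F) (rooted M′ 1F))
  where
  open Reduced G a b u v a≢b u≢v u≢a u≢b v≢a v≢b Na Nb
  open RootedK4Minor using (rooted)
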